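{- For every integer $k\geq 3$ there exists a connected graph $G$ with two distinct minimum dominating sets $D_a, D_b$ of size $k$ such that every reconfiguration sequence from $D_a$ to $D_b$ (through dominating sets of size $k$) contains a move in which all $k$ tokens move and at least $k-2$ of them move by distance at least $2$. In particular, $D_b$ is not reachable from $D_a$ under $(k,1)+(k-3,d)$-Token Jumping for any $d$, nor under $(k-1,d)$-Token Jumping for any $d$.
   Context: A dominating set is a vertex set $D$ such that every vertex is in $D$ or adjacent to a vertex of $D$. A configuration is a set of $k$ vertices (tokens on distinct vertices). A move from configuration $D$ to $D'$ is a bijection $f: D\to D'$; token $v$ moves by distance $\mathrm{dist}_G(v,f(v))$, and it moves if $f(v)\neq v$. Under $(k',d)$-Token Jumping at most $k'$ tokens move and each by distance at most $d$; under $(k,1)+(k',d)$-Token Jumping there is a set of at most $k'$ tokens moving by distance at most $d$ while all others move by distance at most $1$. A reconfiguration sequence is a sequence of configurations, each a dominating set of size $k$, with a move between every two consecutive ones. -}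

module Defs where

open import Level using (0ℓ)
open import Data.Nat using (ℕ; zero; suc; _≤_; _∸_)
open import Data.Fin using (Fin)
open import Data.Product using (Σ; ∃; ∃-syntax; _×_; _,_; proj₁)
open import Data.Sum using (_⊎_)
open import Data.Empty using (⊥)
open import Data.Unit using (⊤)
open import Relation.Nullary using (¬_)
open import Relation.Binary.PropositionalEquality using (_≡_; _≢_)
open import Function.Definitions using (Injective)

record Graph (n : ℕ) : Set₁ where
  field
    Adj     : Fin n → Fin n → Set
    sym     : ∀ {u v} → Adj u v → Adj v u
    irrefl  : ∀ {u} → ¬ Adj u u
open Graph public

module _ {n : ℕ} (G : Graph n) where

  data Walk : Fin n → Fin n → ℕ → Set where
    here : ∀ {u} → Walk u u zero
    next : ∀ {u w v m} → Adj G u w → Walk w v m → Walk u v (suc m)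

  Connected : Set
  Connected = ∀ u v → ∃[ m ] Walk u v m

  DistLE : Fin n → Fin n → ℕ → Set
  DistLE u v d = ∃[ m ] (m ≤ d × Walk u v m)

-- A configuration of k tokens: an injective labelling of the tokens by vertices.
-- The underlying vertex set is the image.
Config : ℕ → ℕ → Set
Config n k = Σ (Fin k → Fin n) (Injective _≡_ _≡_)

InSet : ∀ {n k} → (Fin k → Fin n) → Fin n → Set
InSet c v = ∃[ i ] c i ≡ v

SameSet : ∀ {n k k'} → (Fin k → Fin n) → (Fin k' → Fin n) → Set
SameSet c c' = ∀ v → (InSet c v → InSet c' v) × (InSet c' v → InSet c v)

module _ {n : ℕ} (G : Graph n) where

  Dominating : ∀ {k} → (Fin k → Fin n) → Set
  Dominating c = ∀ v → ∃[ i ] (c i ≡ v ⊎ Adj G (c i) v)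

  MinDomSet : ∀ {k} → Config n k → Set
  MinDomSet {k} (c , _) =
    Dominating c × (∀ m (c' : Config n m) → Dominating (proj₁ c') → k ≤ m)

  -- A move c ⇒ c' (as sets: via the bijection "token i goes from c i to c' i";
  -- every bijection between the underlying sets is of this form after
  -- re-labelling c').  M is an extra restriction on moves (the TJ rule).
  MoveRule : ℕ → Set₁
  MoveRule k = (Fin k → Fin n) → (Fin k → Fin n) → Set

  -- reconfiguration sequences from configuration c to the *set* of d,
  -- all configurations dominating, each step satisfying the rule M.
  data RecSeq {k} (M : MoveRule k) : Config n k → Config n k → Set where
    done : ∀ {c d} → SameSet (proj₁ c) (proj₁ d) → RecSeq M c d
    step : ∀ {c c' d} → Dominating (proj₁ c') → M (proj₁ c) (proj₁ c')
         → RecSeq M c' d → RecSeq M c d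

  Contains : ∀ {k} {M : MoveRule k} {c d} → MoveRule k → RecSeq M c d → Set
  Contains P (done _) = ⊥
  Contains P (step {c = c} {c' = c'} _ _ s) = P (proj₁ c) (proj₁ c') ⊎ Contains P s

  AnyMove : ∀ {k} → MoveRule k
  AnyMove _ _ = ⊤

  AllMoveFar : ∀ {k} → ℕ → MoveRule k
  AllMoveFar {k} j c c' =
    (∀ i → c i ≢ c' i) ×
    Σ (Fin j → Fin k) λ g → Injective _≡_ _≡_ g ×
      (∀ t → ¬ DistLE G (c (g t)) (c' (g t)) 1)

  -- (k',d)-Token Jumping: at most k' tokens move, each by distance ≤ d
  TJ : ∀ {k} → ℕ → ℕ → MoveRule k
  TJ {k} k' d c c' =
    Σ (Fin k' → Fin k) λ g → Injective _≡_ _≡_ g ×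
      (∀ i → (∀ t → g t ≢ i) → c i ≡ c' i) ×
      (∀ i → DistLE G (c i) (c' i) d)

  -- (k,1)+(k',d)-Token Jumping: a set of at most k' tokens moves by ≤ d,
  -- all others by ≤ 1
  TJ+ : ∀ {k} → ℕ → ℕ → MoveRule k
  TJ+ {k} k' d c c' =
    Σ (Fin k' → Fin k) λ g → Injective _≡_ _≡_ g ×
      (∀ i → (∀ t → g t ≢ i) → DistLE G (c i) (c' i) 1) ×
      (∀ i → DistLE G (c i) (c' i) d)

{-# OPTIONS --safe #-}

-- The graph has vertices A x, B y and Z i j (all indices < k); A x — B y is an
-- edge iff x = 0 or y = 0, and Z i j is adjacent exactly to B i and A j.
-- The closed neighbourhoods {Z t t, A t, B t} are pairwise disjoint, so every
-- dominating set has at least k vertices and one of size k has exactly one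
-- token in each of them.  Dominating Z t s (t ≠ s) needs B t or A s, which puts
-- the tokens of t and s on the same side: the only dominating k-sets are
-- {A t} and {B t}.  A reconfiguration sequence from the first to the second
-- therefore contains a move from an all-A to an all-B configuration, and there
-- a token going from A x to B y moves by distance ≥ 2 unless x = 0 or y = 0,
-- which happens for at most two tokens.

module Submission where

open import Defs
open import Data.Nat using (ℕ; zero; suc; _+_; _*_; _≤_; _∸_; s≤s)
open import Data.Nat.Properties using (1+n≰n)
open import Data.Fin using (Fin; zero; suc; punchIn; punchOut; _≟_)
open import Data.Fin.Properties
  using (any?; injective⇒≤; punchIn-injective; punchInᵢ≢i; punchIn-punchOut; punchOut-injective; +↔⊎; *↔×)
open import Data.Product using (Σ; Σ-syntax; _×_; _,_; proj₁; proj₂; ∃-syntax)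
open import Data.Sum using (_⊎_; inj₁; inj₂)
open import Data.Sum.Function.Propositional using (_⊎-↔_)
open import Data.Empty using (⊥; ⊥-elim)
open import Function.Base using (_∘_)
open import Function.Bundles using (Inverse; _↔_)
open import Function.Definitions using (Injective)
open import Function.Properties.Inverse using (↔-refl; ↔-trans)
open import Relation.Nullary using (¬_; yes; no)
open import Relation.Binary.PropositionalEquality
  using (_≡_; _≢_; refl; trans; cong; subst; subst₂) renaming (sym to ≡-sym)

hit-or-miss : ∀ {a k} (g : Fin a → Fin k) (i : Fin k) → (∃[ t ] g t ≡ i) ⊎ (∀ t → g t ≢ i)
hit-or-miss g i with any? (λ t → g t ≟ i)
... | yes hit = inj₁ hit
... | no miss = inj₂ (λ t e → miss (t , e))

injective⇒surjective : ∀ {k} (f : Fin k → Fin k) → Injective _≡_ _≡_ f → ∀ i → ∃[ t ] f t ≡ i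
injective⇒surjective {suc k} f f-inj i with hit-or-miss f i
... | inj₁ hit = hit
... | inj₂ miss = ⊥-elim (1+n≰n (injective⇒≤ {f = squeeze} squeeze-injective))
  where
  squeeze : Fin (suc k) → Fin k
  squeeze t = punchOut (miss t ∘ ≡-sym)

  squeeze-injective : Injective _≡_ _≡_ squeeze
  squeeze-injective e = f-inj (punchOut-injective (miss _ ∘ ≡-sym) (miss _ ∘ ≡-sym) e)

image-⊆⇒≤ : ∀ {a b k} (g : Fin a → Fin k) (h : Fin b → Fin k) → Injective _≡_ _≡_ h →
            (∀ s → ∃[ t ] g t ≡ h s) → b ≤ a
image-⊆⇒≤ g h h-inj covered = injective⇒≤ {f = proj₁ ∘ covered} λ {s} {s′} e →
  h-inj (trans (≡-sym (proj₂ (covered s))) (trans (cong g e) (proj₂ (covered s′))))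

punchIn-hits-at-most-once : ∀ {m} (i j : Fin (suc (suc m))) →
                            ∃[ p ] (∀ t → punchIn i t ≡ j → t ≡ p)
punchIn-hits-at-most-once i j with i ≟ j
... | yes refl = zero , λ t e → ⊥-elim (punchInᵢ≢i i t e)
... | no i≢j = punchOut i≢j , λ t e →
  punchIn-injective i t _ (trans e (≡-sym (punchIn-punchOut i≢j)))

avoid-two : ∀ {m} (i j : Fin (suc (suc m))) →
            Σ[ g ∈ (Fin m → Fin (suc (suc m))) ] Injective _≡_ _≡_ g × (∀ t → g t ≢ i × g t ≢ j)
avoid-two {m} i j with p , only-p ← punchIn-hits-at-most-once i j =
  g , g-injective , λ t → punchInᵢ≢i i _ , λ e → punchInᵢ≢i p t (only-p _ e)
  where
  g : Fin m → Fin (suc (suc m))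
  g t = punchIn i (punchIn p t)

  g-injective : Injective _≡_ _≡_ g
  g-injective e = punchIn-injective p _ _ (punchIn-injective i _ _ e)

module _ {n : ℕ} (G : Graph n) where

  _++ʷ_ : ∀ {u v w a b} → Walk G u v a → Walk G v w b → Walk G u w (a + b)
  here     ++ʷ q = q
  next e p ++ʷ q = next e (p ++ʷ q)

  reverseʷ : ∀ {u v a} → Walk G u v a → ∃[ b ] Walk G v u b
  reverseʷ here       = 0 , here
  reverseʷ (next e p) = _ , proj₂ (reverseʷ p) ++ʷ next (sym G e) here

  hub⇒connected : (h : Fin n) → (∀ u → ∃[ a ] Walk G u h a) → Connected G
  hub⇒connected h to-hub u v = _ , proj₂ (to-hub u) ++ʷ proj₂ (reverseʷ (proj₂ (to-hub v)))

  module _ {k : ℕ} where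

    TJ-budget-≥-movers : ∀ {j d} {c c′ : Fin k → Fin n} →
                         (∀ i → c i ≢ c′ i) → TJ G j d c c′ → k ≤ j
    TJ-budget-≥-movers moves (g , _ , fixed , _) = image-⊆⇒≤ g (λ i → i) (λ e → e) covered
      where
      covered : ∀ i → ∃[ t ] g t ≡ i
      covered i with hit-or-miss g i
      ... | inj₁ hit  = hit
      ... | inj₂ miss = ⊥-elim (moves i (fixed i miss))

    TJ+-budget-≥-far : ∀ {j j′ d} {c c′ : Fin k → Fin n} →
                       AllMoveFar G j c c′ → TJ+ G j′ d c c′ → j ≤ j′
    TJ+-budget-≥-far (_ , h , h-inj , far) (g , _ , near , _) = image-⊆⇒≤ g h h-inj covered
      where
      covered : ∀ s → ∃[ t ] g t ≡ h s
      covered s with hit-or-miss g (h s)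
      ... | inj₁ hit  = hit
      ... | inj₂ miss = ⊥-elim (far s (near (h s) miss))

    leave-region : ∀ {M : MoveRule G k} (S : Config n k → Set) (P : MoveRule G k) {d} →
                   (∀ {c} → S c → ¬ SameSet (proj₁ c) (proj₁ d)) →
                   (∀ {c c′} → S c → Dominating G (proj₁ c′) → M (proj₁ c) (proj₁ c′) →
                      S c′ ⊎ P (proj₁ c) (proj₁ c′)) →
                   ∀ {c} → S c → (s : RecSeq G M c d) → Contains G P s
    leave-region S P outside exit Sc (done same) = outside Sc same
    leave-region S P outside exit Sc (step dom move s) with exit Sc dom move
    ... | inj₁ Sc′ = inj₂ (leave-region S P outside exit Sc′ s)
    ... | inj₂ p   = inj₁ p

    no-forbidden-move : ∀ {M P : MoveRule G k} {c d} → (∀ {x y} → M x y → ¬ P x y) →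
                        (s : RecSeq G M c d) → ¬ Contains G P s
    no-forbidden-move forbidden (step _ move s) (inj₁ p)    = forbidden move p
    no-forbidden-move forbidden (step _ _ s)    (inj₂ rest) = no-forbidden-move forbidden s rest

module GraphOn {V : Set} {n : ℕ} (encoding : Fin n ↔ V) (_~_ : V → V → Set)
               (~-sym : ∀ {x y} → x ~ y → y ~ x) (~-irrefl : ∀ {x} → ¬ x ~ x) where

  open Inverse encoding public using (to; from; strictlyInverseˡ; strictlyInverseʳ)

  graph : Graph n
  graph = record { Adj = λ u v → to u ~ to v ; sym = ~-sym ; irrefl = ~-irrefl }

  Near : V → V → Set
  Near x y = x ≡ y ⊎ x ~ y

  Dominates : ∀ {m} → (Fin m → V) → Set
  Dominates D = ∀ x → ∃[ i ] Near (D i) x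

  to-injective : Injective _≡_ _≡_ to
  to-injective {u} {v} e = trans (≡-sym (strictlyInverseʳ u)) (trans (cong from e) (strictlyInverseʳ v))

  from-injective : Injective _≡_ _≡_ from
  from-injective {x} {y} e = trans (≡-sym (strictlyInverseˡ x)) (trans (cong to e) (strictlyInverseˡ y))

  dominating⇒dominates : ∀ {m} {c : Fin m → Fin n} → Dominating graph c → Dominates (to ∘ c)
  dominating⇒dominates dom x with dom (from x)
  ... | i , inj₁ e   = i , inj₁ (trans (cong to e) (strictlyInverseˡ x))
  ... | i , inj₂ adj = i , inj₂ (subst (_ ~_) (strictlyInverseˡ x) adj)

  dominates⇒dominating : ∀ {m} {D : Fin m → V} → Dominates D → Dominating graph (from ∘ D)
  dominates⇒dominating {D = D} dom u with dom (to u)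
  ... | i , inj₁ e   = i , inj₁ (trans (cong from e) (strictlyInverseʳ u))
  ... | i , inj₂ adj = i , inj₂ (subst (_~ to u) (≡-sym (strictlyInverseˡ (D i))) adj)

  adjacent : ∀ {x y} → x ~ y → Adj graph (from x) (from y)
  adjacent = subst₂ _~_ (≡-sym (strictlyInverseˡ _)) (≡-sym (strictlyInverseˡ _))

  within-1⇒Near : ∀ {u v} → DistLE graph u v 1 → Near (to u) (to v)
  within-1⇒Near (0 , _ , here)          = inj₁ refl
  within-1⇒Near (1 , _ , next adj here) = inj₂ adj
  within-1⇒Near (suc (suc _) , s≤s () , _)

  hub⇒connectedᵛ : (h : V) → (∀ x → ∃[ a ] Walk graph (from x) (from h) a) → Connected graph
  hub⇒connectedᵛ h to-hub = hub⇒connected graph (from h) λ u →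
    subst (λ w → ∃[ a ] Walk graph w (from h) a) (strictlyInverseʳ u) (to-hub (to u))

-- Indexed by m = k - 2, so that k ∸ 2 in the statement computes to m.
module Construction (m : ℕ) where

  k : ℕ
  k = suc (suc m)

  V : Set
  V = Fin k ⊎ Fin k ⊎ Fin k × Fin k

  pattern A x   = inj₁ x
  pattern B y   = inj₂ (inj₁ y)
  pattern Z i j = inj₂ (inj₂ (i , j))

  n : ℕ
  n = k + (k + k * k)

  encoding : Fin n ↔ V
  encoding = ↔-trans +↔⊎ (↔-refl ⊎-↔ ↔-trans +↔⊎ (↔-refl ⊎-↔ *↔×))

  _~_ : V → V → Set
  A x   ~ B y   = x ≡ zero ⊎ y ≡ zero
  B y   ~ A x   = x ≡ zero ⊎ y ≡ zero
  Z i j ~ B y   = i ≡ y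
  B y   ~ Z i j = i ≡ y
  Z i j ~ A x   = j ≡ x
  A x   ~ Z i j = j ≡ x
  _     ~ _     = ⊥

  ~-sym : ∀ {x y} → x ~ y → y ~ x
  ~-sym {A _}   {B _}   adj = adj
  ~-sym {B _}   {A _}   adj = adj
  ~-sym {Z _ _} {B _}   adj = adj
  ~-sym {B _}   {Z _ _} adj = adj
  ~-sym {Z _ _} {A _}   adj = adj
  ~-sym {A _}   {Z _ _} adj = adj

  ~-irrefl : ∀ {x} → ¬ x ~ x
  ~-irrefl {A _}   ()
  ~-irrefl {B _}   ()
  ~-irrefl {Z _ _} ()

  open GraphOn encoding _~_ ~-sym ~-irrefl

  G : Graph n
  G = graph

  A≢B : ∀ {x y} → _≢_ {A = V} (A x) (B y)
  A≢B ()

  A-B-far : ∀ {x y} → x ≢ zero → y ≢ zero → ¬ Near (A x) (B y)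
  A-B-far x≢0 y≢0 (inj₂ (inj₁ x≡0)) = x≢0 x≡0
  A-B-far x≢0 y≢0 (inj₂ (inj₂ y≡0)) = y≢0 y≡0

  data Side : Set where
    A-side B-side : Side

  at : Side → Fin k → V
  at A-side t = A t
  at B-side t = B t

  at-side-injective : ∀ {σ τ t s} → at σ t ≡ at τ s → σ ≡ τ
  at-side-injective {A-side} {A-side} _ = refl
  at-side-injective {B-side} {B-side} _ = refl

  OnSide : ∀ {m′} → Side → (Fin m′ → V) → Set
  OnSide σ D = ∀ i → ∃[ t ] D i ≡ at σ t

  data Ball (t : Fin k) : V → Set where
    centre : Ball t (Z t t)
    a-end  : Ball t (A t)
    b-end  : Ball t (B t)

  at-Ball : ∀ σ t → Ball t (at σ t)
  at-Ball A-side t = a-end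
  at-Ball B-side t = b-end

  Near⇒Ball : ∀ {t x} → Near x (Z t t) → Ball t x
  Near⇒Ball              (inj₁ refl) = centre
  Near⇒Ball {x = A _}    (inj₂ refl) = a-end
  Near⇒Ball {x = B _}    (inj₂ refl) = b-end

  Ball-unique : ∀ {t s x} → Ball t x → Ball s x → t ≡ s
  Ball-unique centre centre = refl
  Ball-unique a-end  a-end  = refl
  Ball-unique b-end  b-end  = refl

  Ball-Near-off-diagonal : ∀ {r t s x} → t ≢ s → Ball r x → Near x (Z t s) → x ≡ B t ⊎ x ≡ A s
  Ball-Near-off-diagonal t≢s centre (inj₁ refl) = ⊥-elim (t≢s refl)
  Ball-Near-off-diagonal t≢s a-end  (inj₂ refl) = inj₂ refl
  Ball-Near-off-diagonal t≢s b-end  (inj₂ refl) = inj₁ refl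

  module Guards {m′} {D : Fin m′ → V} (dom : Dominates D) where

    guard : Fin k → Fin m′
    guard t = proj₁ (dom (Z t t))

    guard-Ball : ∀ t → Ball t (D (guard t))
    guard-Ball t = Near⇒Ball (proj₂ (dom (Z t t)))

    guard-injective : Injective _≡_ _≡_ guard
    guard-injective {t} {s} e = Ball-unique (guard-Ball t) (subst (Ball s ∘ D) (≡-sym e) (guard-Ball s))

  dominating-set-size : ∀ {m′} {D : Fin m′ → V} → Dominates D → k ≤ m′
  dominating-set-size dom = injective⇒≤ (Guards.guard-injective dom)

  module Classify {D : Fin k → V} (dom : Dominates D) where

    open Guards dom

    home : Fin k → Fin k
    home i = proj₁ (injective⇒surjective guard guard-injective i)

    guard-home : ∀ i → guard (home i) ≡ i
    guard-home i = proj₂ (injective⇒surjective guard guard-injective i)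

    token-Ball : ∀ i → Ball (home i) (D i)
    token-Ball i = subst (Ball (home i) ∘ D) (guard-home i) (guard-Ball (home i))

    guard-unique : ∀ {t i} → Ball t (D i) → guard t ≡ i
    guard-unique {i = i} ball =
      trans (cong guard (Ball-unique ball (token-Ball i))) (guard-home i)

    off-diagonal : ∀ {t s} → t ≢ s → D (guard t) ≡ B t ⊎ D (guard s) ≡ A s
    off-diagonal {t} {s} t≢s with j , near ← dom (Z t s)
                             with Ball-Near-off-diagonal t≢s (token-Ball j) near
    ... | inj₁ e = inj₁ (trans (cong D (guard-unique (subst (Ball t) (≡-sym e) b-end))) e)
    ... | inj₂ e = inj₂ (trans (cong D (guard-unique (subst (Ball s) (≡-sym e) a-end))) e)

    same-side : ∀ {t s} → t ≢ s → ∃[ σ ] (D (guard t) ≡ at σ t × D (guard s) ≡ at σ s)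
    same-side t≢s with off-diagonal t≢s | off-diagonal (t≢s ∘ ≡-sym)
    ... | inj₁ t-B | inj₁ s-B = B-side , t-B , s-B
    ... | inj₂ s-A | inj₂ t-A = A-side , t-A , s-A
    ... | inj₁ t-B | inj₂ t-A = ⊥-elim (A≢B (trans (≡-sym t-A) t-B))
    ... | inj₂ s-A | inj₁ s-B = ⊥-elim (A≢B (trans (≡-sym s-A) s-B))

    uniform : ∃[ σ ] ∀ t → D (guard t) ≡ at σ t
    uniform with σ , zero-σ , _ ← same-side {zero} {suc zero} (λ ()) = σ , on-σ
      where
      on-σ : ∀ t → D (guard t) ≡ at σ t
      on-σ t with zero ≟ t
      ... | yes refl = zero-σ
      ... | no 0≢t with τ , zero-τ , t-τ ← same-side 0≢t
        rewrite at-side-injective (trans (≡-sym zero-σ) zero-τ) = t-τ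

    classify : ∃[ σ ] OnSide σ D
    classify with σ , on-σ ← uniform =
      σ , λ i → home i , trans (cong D (≡-sym (guard-home i))) (on-σ (home i))

  occupied-corner : ∀ {m′ σ} {D : Fin m′ → V} → Dominates D → OnSide σ D → ∃[ i ] D i ≡ at σ zero
  occupied-corner {σ = σ} {D} dom on-σ with i , near ← dom (Z zero zero) with t , e ← on-σ i =
    i , subst (λ s → D i ≡ at σ s) (Ball-unique (at-Ball σ t) (subst (Ball zero) e (Near⇒Ball near))) e

  off-corner : ∀ {m′ σ i i₀ x} {D : Fin m′ → V} → Injective _≡_ _≡_ D →
               D i₀ ≡ at σ zero → D i ≡ at σ x → i ≢ i₀ → x ≢ zero
  off-corner D-inj corner e i≢i₀ refl = i≢i₀ (D-inj (trans e (≡-sym corner)))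

  side-config : Side → Config n k
  side-config σ = from ∘ at σ , λ e → at-injective (from-injective e)
    where
    at-injective : ∀ {t s} → at σ t ≡ at σ s → t ≡ s
    at-injective {t} {s} e = Ball-unique (at-Ball σ t) (subst (Ball s) (≡-sym e) (at-Ball σ s))

  Da Db : Config n k
  Da = side-config A-side
  Db = side-config B-side

  side-dominates : ∀ σ → Dominates (at σ)
  side-dominates A-side (A x)   = x , inj₁ refl
  side-dominates A-side (B y)   = zero , inj₂ (inj₁ refl)
  side-dominates A-side (Z i j) = j , inj₂ refl
  side-dominates B-side (A x)   = zero , inj₂ (inj₂ refl)
  side-dominates B-side (B y)   = y , inj₁ refl
  side-dominates B-side (Z i j) = i , inj₂ refl

  side-minimum : ∀ σ → MinDomSet G (side-config σ)
  side-minimum σ = dominates⇒dominating (side-dominates σ) ,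
                   λ _ _ dom → dominating-set-size (dominating⇒dominates dom)

  OnA : Config n k → Set
  OnA (c , _) = Dominating G c × OnSide A-side (to ∘ c)

  Da-OnA : OnA Da
  Da-OnA = dominates⇒dominating (side-dominates A-side) ,
           λ i → i , strictlyInverseˡ (A i)

  OnA-outside-Db : ∀ {c} → OnA c → ¬ SameSet (proj₁ c) (proj₁ Db)
  OnA-outside-Db {c , _} (_ , on-A) same with j , e ← proj₁ (same (c zero)) (zero , refl)
                                        with x , c0≡A ← on-A zero =
    A≢B (trans (≡-sym c0≡A) (trans (cong to (≡-sym e)) (strictlyInverseˡ (B j))))

  Da≢Db : ¬ SameSet (proj₁ Da) (proj₁ Db)
  Da≢Db = OnA-outside-Db {Da} Da-OnA

  far-tokens : ∀ {D D′ : Fin k → V} → Injective _≡_ _≡_ D → Injective _≡_ _≡_ D′ →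
               Dominates D → OnSide A-side D → Dominates D′ → OnSide B-side D′ →
               Σ[ g ∈ (Fin m → Fin k) ] Injective _≡_ _≡_ g × (∀ t → ¬ Near (D (g t)) (D′ (g t)))
  far-tokens {D} {D′} D-inj D′-inj dom on-A dom′ on-B
    with i₀ , D-i₀ ← occupied-corner dom on-A
    with i₁ , D′-i₁ ← occupied-corner dom′ on-B
    with g , g-injective , avoids ← avoid-two i₀ i₁ = g , g-injective , far
    where
    far : ∀ t → ¬ Near (D (g t)) (D′ (g t))
    far t with x , ex ← on-A (g t) with y , ey ← on-B (g t) rewrite ex | ey =
      A-B-far (off-corner D-inj D-i₀ ex (proj₁ (avoids t))) (off-corner D′-inj D′-i₁ ey (proj₂ (avoids t)))

  A-to-B-is-far : ∀ {c c′ : Config n k} → OnA c → Dominating G (proj₁ c′) →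
                  OnSide B-side (to ∘ proj₁ c′) → AllMoveFar G m (proj₁ c) (proj₁ c′)
  A-to-B-is-far {c , c-inj} {c′ , c′-inj} (dom , on-A) dom′ on-B
    with g , g-injective , far ← far-tokens (λ e → c-inj (to-injective e)) (λ e → c′-inj (to-injective e))
                                   (dominating⇒dominates dom) on-A (dominating⇒dominates dom′) on-B =
    moves , g , g-injective , λ t → far t ∘ within-1⇒Near
    where
    moves : ∀ i → c i ≢ c′ i
    moves i e = A≢B (trans (≡-sym (proj₂ (on-A i))) (trans (cong to e) (proj₂ (on-B i))))

  OnA-step : ∀ {c c′ : Config n k} → OnA c → Dominating G (proj₁ c′) →
             OnA c′ ⊎ AllMoveFar G m (proj₁ c) (proj₁ c′)
  OnA-step {c} {c′} on-A dom′ = by-side (Classify.classify (dominating⇒dominates dom′))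
    where
    by-side : ∃[ σ ] OnSide σ (to ∘ proj₁ c′) → OnA c′ ⊎ AllMoveFar G m (proj₁ c) (proj₁ c′)
    by-side (A-side , on-A′) = inj₁ (dom′ , on-A′)
    by-side (B-side , on-B′) = inj₂ (A-to-B-is-far {c} {c′} on-A dom′ on-B′)

  every-sequence-has-far-move : ∀ {M} (s : RecSeq G M Da Db) → Contains G (AllMoveFar G m) s
  every-sequence-has-far-move = leave-region G OnA (AllMoveFar G m) (λ {c} → OnA-outside-Db {c})
                                  (λ {c} {c′} on-A dom′ _ → OnA-step {c} {c′} on-A dom′) Da-OnA

  connected : Connected G
  connected = hub⇒connectedᵛ (A zero) to-hub
    where
    through-B : ∀ x i → x ~ B i → Walk G (from x) (from (A zero)) 2
    through-B x i adj =
      next {w = from (B i)} (adjacent {x} adj) (next (adjacent {B i} {A zero} (inj₁ refl)) here)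

    to-hub : ∀ x → ∃[ a ] Walk G (from x) (from (A zero)) a
    to-hub (A x)   = 2 , through-B (A x) zero (inj₂ refl)
    to-hub (B y)   = 1 , next (adjacent {B y} {A zero} (inj₁ refl)) here
    to-hub (Z i j) = 2 , through-B (Z i j) i refl

proposition2 : (k : ℕ) → 3 ≤ k →
    Σ ℕ λ n → Σ (Graph n) λ G → Connected G ×
    Σ (Config n k) λ Da → Σ (Config n k) λ Db →
      MinDomSet G Da × MinDomSet G Db × ¬ SameSet (proj₁ Da) (proj₁ Db) ×
      ((s : RecSeq G (AnyMove G) Da Db) → Contains G (AllMoveFar G (k ∸ 2)) s) ×
      ((d : ℕ) → ¬ RecSeq G (TJ+ G (k ∸ 3) d) Da Db) ×
      ((d : ℕ) → ¬ RecSeq G (TJ G (k ∸ 1) d) Da Db)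
proposition2 0 ()
proposition2 1 (s≤s ())
proposition2 2 (s≤s (s≤s ()))
proposition2 (suc (suc (suc m))) _ =
  n , G , connected , Da , Db , side-minimum A-side , side-minimum B-side , Da≢Db ,
  every-sequence-has-far-move , no-TJ+ , no-TJ
  where
  open Construction (suc m)

  no-TJ+ : (d : ℕ) → ¬ RecSeq G (TJ+ G m d) Da Db
  no-TJ+ d s = no-forbidden-move G (λ tj far → 1+n≰n (TJ+-budget-≥-far G far tj))
                 s (every-sequence-has-far-move s)

  no-TJ : (d : ℕ) → ¬ RecSeq G (TJ G (suc (suc m)) d) Da Db
  no-TJ d s = no-forbidden-move G (λ tj far → 1+n≰n (TJ-budget-≥-movers G (proj₁ far) tj))
                s (every-sequence-has-far-move s)
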